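{- Let $(G,\mathsf{m})$ be a marked graph. Then the $M$-polynomial $M_{(G,\mathsf m)}(\mathbf z,y)$ is well-defined (independent of the order in which rules (b) and (c) below are applied), and $$M_{(G,\mathsf{m})}(\mathbf{z},y)=\sum_{A\subseteq E(G)}\mathbf{z}_{\lambda(G,\mathsf{m},A)}\,(y-1)^{|A|-r_G(A)}.$$
   Context: Graphs are finite and may have loops and multiple edges. A mark is a pair $(w,d)$ of integers with $w\ge1$, $d\ge0$ and $w\ge d+1$; the set of marks $\mathbb M$ carries the dot-sum $(w,d)\dotplus(w',d')=(w+w',d+d'+1)$. A marked graph is a pair $(G,\mathsf m)$ with $\mathsf m:V(G)\to\mathbb M$. Deletion: $(G\setminus e,\mathsf m)$ deletes the edge $e$. Contraction of a non-loop edge $e=uv$: $(G/e,\mathsf m/e)$ deletes $e$, merges $u,v$ into a new vertex $v_e$ which inherits all other edges incident with $u$ or $v$, with $(\mathsf m/e)(v_e)=\mathsf m(u)\dotplus\mathsf m(v)$ and other marks unchanged. Let $y$ and $z_{w,d}$ ($(w,d)\in\mathbb M$) be commuting indeterminates. The $M$-polynomial is defined by the rules: (a) if $G$ has no edges and its vertices have marks $(w_1,d_1),\dots,(w_k,d_k)$, then $M_{(G,\mathsf m)}=z_{w_1,d_1}\cdots z_{w_k,d_k}$; (b) if $e$ is a loop, $M_{(G,\mathsf m)}=y\,M_{(G\setminus e,\mathsf m)}$; (c) if $e$ is a non-loop edge, $M_{(G,\mathsf m)}=M_{(G\setminus e,\mathsf m)}+M_{(G/e,\mathsf m/e)}$.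 For $A\subseteq E(G)$, $G|_A$ is the spanning subgraph with edge set $A$, $k(G|_A)$ its number of connected components, and $r_G(A)=|V(G)|-k(G|_A)$. The total mark of a vertex set $U$ is the dot-sum of the marks of the vertices of $U$; $\lambda(G,\mathsf m,A)$ is the multiset of total marks of the vertex sets of the connected components of $G|_A$, and for a multiset $\lambda=\{(w_1,d_1),\dots,(w_l,d_l)\}$ of marks, $\mathbf z_\lambda=z_{w_1,d_1}\cdots z_{w_l,d_l}$. -}

module Defs where

open import Level using (Level)
open import Data.Nat as ℕ using (ℕ; zero; suc; _≤_; _∸_)
open import Data.Nat.Properties using (+-mono-≤; +-suc)
import Data.Nat.Properties
import Relation.Binary.PropositionalEquality
open import Data.Fin using (Fin; zero; suc; _≟_; punchOut; punchIn)
open import Data.Fin.Subset using (Subset; inside; outside; _∈_; ∣_∣)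
open import Data.Vec using (Vec; []; _∷_; removeAt; map)
open import Data.Vec.Relation.Unary.Any using ()
open import Data.List using (List; []; _∷_; foldl; filter; allFin) renaming (map to lmap)
open import Data.Product using (_×_; _,_; proj₁; proj₂)
open import Data.Sum using (_⊎_)
open import Relation.Nullary using (¬_; Dec; yes; no; does)
open import Relation.Nullary.Decidable using (_×-dec_; ¬?)
open import Relation.Binary.PropositionalEquality using (_≡_; _≢_; refl; subst; sym)
open import Algebra.Bundles using (CommutativeRing)

record Mark : Set where
  constructor mark
  field
    w : ℕ
    d : ℕ
    .valid : suc d ≤ w
open Mark public

private
  dot-valid : ∀ {w d w′ d′} → suc d ≤ w → suc d′ ≤ w′ → suc (d ℕ.+ d′ ℕ.+ 1) ≤ w ℕ.+ w′
  dot-valid {w} {d} {w′} {d′} p q =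
    subst (_≤ w ℕ.+ w′) (eq d d′) (+-mono-≤ p q)
    where
    eq : ∀ a b → suc a ℕ.+ suc b ≡ suc (a ℕ.+ b ℕ.+ 1)
    eq zero b = Relation.Binary.PropositionalEquality.cong suc (sym (Data.Nat.Properties.+-comm b 1))
    eq (suc a) b rewrite eq a b = refl

_∔_ : Mark → Mark → Mark
mark w d p ∔ mark w′ d′ q = mark (w ℕ.+ w′) (d ℕ.+ d′ ℕ.+ 1) (dot-valid p q)

-- Marked graphs: vertex set Fin n, edges given by a vector of m
-- (ordered pairs of) endpoints (loops and multiple edges allowed),
-- marking  mk : Fin n → Mark.

Edges : ℕ → ℕ → Set
Edges n m = Vec (Fin n × Fin n) m

-- Contraction of a non-loop edge with endpoints u ≢ v in a graph on Fin (suc n):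
-- vertex x is sent to the vertex of Fin n obtained by deleting u,
-- where u itself is identified with v.  The merged vertex v_e is
-- punchOut u≢v (the image of both u and v).
mergeV : ∀ {n} (u v : Fin (suc n)) → u ≢ v → Fin (suc n) → Fin n
mergeV u v u≢v x with x ≟ u
... | yes _  = punchOut u≢v
... | no x≢u = punchOut (λ u≡x → x≢u (sym u≡x))

contractMarks : ∀ {n} (u v : Fin (suc n)) → u ≢ v → (Fin (suc n) → Mark) → Fin n → Mark
contractMarks u v u≢v mk j with j ≟ punchOut u≢v
... | yes _ = mk u ∔ mk v
... | no _  = mk (punchIn u j)

contractEdges : ∀ {n m} (u v : Fin (suc n)) → u ≢ v → Edges (suc n) m → Edges n m
contractEdges u v u≢v = map (λ e → mergeV u v u≢v (proj₁ e) , mergeV u v u≢v (proj₂ e))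

data Reachable {n m} (E : Edges n m) (A : Subset m) (s : Fin n) : Fin n → Set where
  here : Reachable E A s s
  step : ∀ {a b} (i : Fin m) → i ∈ A →
         (Data.Vec.lookup E i ≡ (a , b) ⊎ Data.Vec.lookup E i ≡ (b , a)) →
         Reachable E A s a → Reachable E A s b

-- The representatives (c r ≡ r) are then exactly one vertex per component.
record IsComponentLabelling {n m} (E : Edges n m) (A : Subset m) (c : Fin n → Fin n) : Set where
  field
    inComponent : ∀ v → Reachable E A v (c v)
    constant    : ∀ u v → Reachable E A u v → c u ≡ c v

vertices : (n : ℕ) → List (Fin n)
vertices n = allFin n

representatives : ∀ {n} → (Fin n → Fin n) → List (Fin n)
representatives {n} c = filter (λ r → c r ≟ r) (vertices n)

numComponents : ∀ {n} → (Fin n → Fin n) → ℕ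
numComponents c = Data.List.length (representatives c)

totalMark : ∀ {n} → (Fin n → Mark) → (Fin n → Fin n) → Fin n → Mark
totalMark {n} mk c r =
  foldl _∔_ (mk r)
    (lmap mk (filter (λ v → ¬? (v ≟ r) ×-dec (c v ≟ r)) (vertices n)))

-- Ring-valued part: the M-polynomial is evaluated in an arbitrary
-- commutative ring R at z : Mark → R and y : R.

module WithRing {c ℓ : Level} (R : CommutativeRing c ℓ) where
  open CommutativeRing R using (Carrier; _+_; _*_; -_; 0#; 1#)

  prodList : List Carrier → Carrier
  prodList = Data.List.foldr _*_ 1#

  prodFin : ∀ {n} → (Fin n → Carrier) → Carrier
  prodFin {zero}  f = 1#
  prodFin {suc n} f = f zero * prodFin (λ i → f (suc i))

  pow : Carrier → ℕ → Carrier
  pow x zero    = 1#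
  pow x (suc k) = x * pow x k

  sumSubsets : ∀ m → (Subset m → Carrier) → Carrier
  sumSubsets zero    f = f []
  sumSubsets (suc m) f = sumSubsets m (λ A → f (outside ∷ A)) + sumSubsets m (λ A → f (inside ∷ A))

  module _ (z : Mark → Carrier) (y : Carrier) where

    -- Computes E mk v : "v is a value obtained for M_{(G,mk)} by applying
    -- rules (a), (b), (c) in some order" (any edge may be chosen at each step).
    data Computes : ∀ {n m} → Edges n m → (Fin n → Mark) → Carrier → Set (c Level.⊔ ℓ) where
      ruleA : ∀ {n} (mk : Fin n → Mark) →
              Computes [] mk (prodFin (λ v → z (mk v)))
      ruleB : ∀ {n m} (E : Edges n (suc m)) (mk : Fin n → Mark) (i : Fin (suc m)) {val} →
              proj₁ (Data.Vec.lookup E i) ≡ proj₂ (Data.Vec.lookup E i) →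
              Computes (removeAt E i) mk val →
              Computes E mk (y * val)
      ruleC : ∀ {n m} (E : Edges (suc n) (suc m)) (mk : Fin (suc n) → Mark) (i : Fin (suc m))
              (u≢v : proj₁ (Data.Vec.lookup E i) ≢ proj₂ (Data.Vec.lookup E i)) {val₁ val₂} →
              Computes (removeAt E i) mk val₁ →
              Computes (contractEdges _ _ u≢v (removeAt E i))
                       (contractMarks _ _ u≢v mk) val₂ →
              Computes E mk (val₁ + val₂)

    -- z_{λ(G,m,A)} (y-1)^{|A| - r_G(A)}, where c is a component labelling of G|_A
    -- and r_G(A) = n - k(G|_A).
    term : ∀ {n m} → (Fin n → Mark) → Subset m → (Fin n → Fin n) → Carrier
    term {n} mk A c =
      prodList (lmap (λ r → z (totalMark mk c r)) (representatives c))
      * pow (y + (- 1#)) (∣ A ∣ ∸ (n ∸ numComponents c))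

    subsetSum : ∀ {n m} → Edges n m → (Fin n → Mark) → (Subset m → Fin n → Fin n) → Carrier
    subsetSum {n} {m} E mk C = sumSubsets m (λ A → term mk A (C A))

{-# OPTIONS --safe #-}

-- Both sides satisfy the same deletion–contraction recurrence. Split the subsets A ⊆ E(G) by whether
-- a chosen edge e lies in A. The subsets avoiding e are the subsets of G∖e, with the same components.
-- If e is a loop, adding it to A changes neither the components nor r(A), so it multiplies the term
-- by y − 1, and x + (y − 1)x = yx is rule (b). If e = uv is not a loop, A ∪ {e} ↦ A is a bijection
-- onto the subsets of G/e, under which the components of G|_{A ∪ {e}} become those of (G/e)|_A by
-- merging u with v; total marks agree because the dot-sum is associative and commutative, and
-- |A| − r(A) is unchanged.

module Submission where

open import Defs
open import Level using (Level)
open import Algebra.Bundles using (CommutativeMonoid; CommutativeRing)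
import Algebra.Properties.CommutativeMonoid.Sum as CommutativeMonoidSum
import Algebra.Properties.Ring as RingProperties
import Algebra.Properties.CommutativeSemigroup as CommutativeSemigroupProperties
open import Data.Bool using (Bool; true; false; if_then_else_)
open import Data.Empty using (⊥-elim)
open import Data.Fin using (Fin; zero; suc; punchIn; punchOut; _≟_)
open import Data.Fin.Properties
  using (punchInᵢ≢i; punchIn-punchOut; punchOut-punchIn; punchOut-cong; punchOut-injective)
open import Data.Fin.Subset using (Subset; inside; outside; _∈_; ∣_∣)
open import Data.List using ([]; _∷_; foldl; foldr; filter; length; tabulate) renaming (map to lmap)
open import Data.List.Properties using (filter-none)
open import Data.List.Relation.Unary.All.Properties using (tabulate⁺)
open import Data.Nat as ℕ using (ℕ; zero; suc; _∸_; _≤_; z≤n; s≤s)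
import Data.Nat.Properties as ℕₚ
open import Data.Product using (Σ; _×_; _,_; proj₁; proj₂)
open import Data.Sum using (_⊎_; inj₁; inj₂; [_,_])
open import Data.Vec using (Vec; []; _∷_; lookup; removeAt; insertAt; here; there)
open import Data.Vec.Properties using (lookup-map; insertAt-lookup; insertAt-punchIn; []=⇒lookup; lookup⇒[]=)
open import Function using (_∘_; id; _⇔_; mk⇔; Equivalence)
open import Relation.Nullary using (Dec; yes; no; does)
open import Relation.Nullary.Decidable using (_×-dec_; ¬?; does-⇔; dec-true; dec-false)
open import Relation.Binary.PropositionalEquality
  using (_≡_; _≢_; refl; sym; trans; cong; cong₂; subst; module ≡-Reasoning)

module _ {a ℓ} (M : CommutativeMonoid a ℓ) where
  open CommutativeMonoid M hiding (refl; sym; trans)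
  open CommutativeMonoid M using () renaming (refl to ≈-refl; sym to ≈-sym; trans to ≈-trans)
  open CommutativeMonoidSum M using (sum; sum-remove; sum-cong-≋)
  open import Relation.Binary.Reasoning.Setoid setoid

  sum-merge : ∀ {n} (u v : Fin (suc n)) (u≢v : u ≢ v)
              (f : Fin (suc n) → Carrier) (g : Fin n → Carrier) →
              g (punchOut u≢v) ≈ f u ∙ f v →
              (∀ j → j ≢ punchOut u≢v → g j ≈ f (punchIn u j)) →
              sum f ≈ sum g
  sum-merge {zero} u v u≢v f g _ _ with punchOut u≢v
  ... | ()
  sum-merge {suc n} u v u≢v f g g-merged g-other = begin
    sum f                                ≈⟨ sum-remove {i = u} f ⟩
    f u ∙ sum (f ∘ punchIn u)            ≈⟨ ∙-congˡ (sum-remove {i = j₀} (f ∘ punchIn u)) ⟩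
    f u ∙ (f (punchIn u j₀) ∙ sum rest)  ≡⟨ cong (λ x → f u ∙ (f x ∙ sum rest)) (punchIn-punchOut u≢v) ⟩
    f u ∙ (f v ∙ sum rest)               ≈⟨ ≈-sym (assoc _ _ _) ⟩
    (f u ∙ f v) ∙ sum rest               ≈⟨ ∙-cong (≈-sym g-merged)
                                              (sum-cong-≋ (λ k → ≈-sym (g-other _ (punchInᵢ≢i j₀ k)))) ⟩
    g j₀ ∙ sum (g ∘ punchIn j₀)          ≈⟨ ≈-sym (sum-remove {i = j₀} g) ⟩
    sum g                                ∎
    where
    j₀ = punchOut u≢v
    rest = f ∘ punchIn u ∘ punchIn j₀

  sumRepresentatives : ∀ {n} → (Fin n → Fin n) → (Fin n → Carrier) → Carrier
  sumRepresentatives c g = sum (λ x → if does (c x ≟ x) then g x else ε)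

  foldr-filter-tabulate : ∀ {b p} {B : Set b} {P : B → Set p} (P? : ∀ x → Dec (P x))
    (h : B → Carrier) {n} (f : Fin n → B) →
    foldr _∙_ ε (lmap h (filter P? (tabulate f))) ≈ sum (λ x → if does (P? (f x)) then h (f x) else ε)
  foldr-filter-tabulate P? h {zero} f = ≈-refl
  foldr-filter-tabulate P? h {suc n} f with does (P? (f zero))
  ... | true  = ∙-congˡ (foldr-filter-tabulate P? h (f ∘ suc))
  ... | false = ≈-trans (foldr-filter-tabulate P? h (f ∘ suc)) (≈-sym (identityˡ _))

open CommutativeMonoidSum ℕₚ.+-0-commutativeMonoid using () renaming (sum to sumℕ)

count : ∀ {n} → (Fin n → Bool) → ℕ
count p = sumℕ (λ x → if p x then 1 else 0)

count≤ : ∀ {n} (p : Fin n → Bool) → count p ≤ n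
count≤ {zero}  p = z≤n
count≤ {suc n} p with p zero
... | true  = s≤s (count≤ (p ∘ suc))
... | false = ℕₚ.m≤n⇒m≤1+n (count≤ (p ∘ suc))

count-true : ∀ {n} (p : Fin n → Bool) → (∀ x → p x ≡ true) → count p ≡ n
count-true {zero}  p _ = refl
count-true {suc n} p all rewrite all zero = cong suc (count-true (p ∘ suc) (all ∘ suc))

length-filter-tabulate : ∀ {b q} {B : Set b} {Q : B → Set q} (Q? : ∀ x → Dec (Q x)) {n} (f : Fin n → B) →
  length (filter Q? (tabulate f)) ≡ count (λ x → does (Q? (f x)))
length-filter-tabulate Q? {zero}  f = refl
length-filter-tabulate Q? {suc n} f with does (Q? (f zero))
... | true  = cong suc (length-filter-tabulate Q? (f ∘ suc))
... | false = length-filter-tabulate Q? (f ∘ suc)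

componentCount : ∀ {n} → (Fin n → Fin n) → ℕ
componentCount c = count (λ x → does (c x ≟ x))

nullity : ∀ {n m} → Subset m → (Fin n → Fin n) → ℕ
nullity {n} A c = ∣ A ∣ ∸ (n ∸ componentCount c)

componentCount-discrete : ∀ {n} (c : Fin n → Fin n) → (∀ x → c x ≡ x) → componentCount c ≡ n
componentCount-discrete c c-id = count-true _ (λ x → dec-true (c x ≟ x) (c-id x))

numComponents≡componentCount : ∀ {n} (c : Fin n → Fin n) → numComponents c ≡ componentCount c
numComponents≡componentCount c = length-filter-tabulate (λ r → c r ≟ r) id

Orient : ∀ {n} → Fin n × Fin n → Fin n → Fin n → Set
Orient e a b = e ≡ (a , b) ⊎ e ≡ (b , a)

Adjacent : ∀ {n m} → Edges n m → Subset m → Fin n → Fin n → Set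
Adjacent {m = m} E A a b = Σ (Fin m) λ i → i ∈ A × Orient (lookup E i) a b

module _ {n m} {E : Edges n m} {A : Subset m} where

  Reachable-prepend : ∀ {s′ s t} i → i ∈ A → Orient (lookup E i) s′ s →
                      Reachable E A s t → Reachable E A s′ t
  Reachable-prepend i i∈A o here             = step i i∈A o here
  Reachable-prepend i i∈A o (step j j∈A o′ p) = step j j∈A o′ (Reachable-prepend i i∈A o p)

  Reachable-sym : ∀ {s t} → Reachable E A s t → Reachable E A t s
  Reachable-sym here                    = here
  Reachable-sym (step i i∈A (inj₁ e) p) = Reachable-prepend i i∈A (inj₂ e) (Reachable-sym p)
  Reachable-sym (step i i∈A (inj₂ e) p) = Reachable-prepend i i∈A (inj₁ e) (Reachable-sym p)

  Reachable-trans : ∀ {s a b} → Reachable E A s a → Reachable E A a b → Reachable E A s b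
  Reachable-trans p here              = p
  Reachable-trans p (step i i∈A o q) = step i i∈A o (Reachable-trans p q)

Reachable-map : ∀ {n m n′ m′} {E : Edges n m} {A : Subset m} {E′ : Edges n′ m′} {A′ : Subset m′}
  (φ : Fin n → Fin n′) →
  (∀ {a b} i → i ∈ A → Orient (lookup E i) a b → φ a ≡ φ b ⊎ Adjacent E′ A′ (φ a) (φ b)) →
  ∀ {s t} → Reachable E A s t → Reachable E′ A′ (φ s) (φ t)
Reachable-map φ edge here = here
Reachable-map φ edge (step i i∈A o p) with edge i i∈A o
... | inj₁ φa≡φb            = subst (Reachable _ _ _) φa≡φb (Reachable-map φ edge p)
... | inj₂ (k , k∈A′ , o′) = step k k∈A′ o′ (Reachable-map φ edge p)

Reachable-[] : ∀ {n} {s t : Fin n} → Reachable [] [] s t → s ≡ t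
Reachable-[] here = refl

labelling-idem : ∀ {n m} {E : Edges n m} {A : Subset m} {c : Fin n → Fin n} →
                 IsComponentLabelling E A c → ∀ x → c (c x) ≡ c x
labelling-idem {c = c} L x = sym (constant x (c x) (inComponent x))
  where open IsComponentLabelling L

labelling-[] : ∀ {n} {c : Fin n → Fin n} → IsComponentLabelling [] [] c → ∀ x → c x ≡ x
labelling-[] L x = sym (Reachable-[] (IsComponentLabelling.inComponent L x))

lookup-removeAt : ∀ {a} {X : Set a} {m} (xs : Vec X (suc m)) i k →
                  lookup (removeAt xs i) k ≡ lookup xs (punchIn i k)
lookup-removeAt (x ∷ xs)     zero    k       = refl
lookup-removeAt (x ∷ y ∷ xs) (suc i) zero    = refl
lookup-removeAt (x ∷ y ∷ xs) (suc i) (suc k) = lookup-removeAt (y ∷ xs) i k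

≡⊎punchIn : ∀ {m} (i j : Fin (suc m)) → j ≡ i ⊎ Σ (Fin m) (λ k → j ≡ punchIn i k)
≡⊎punchIn i j with i ≟ j
... | yes i≡j = inj₁ (sym i≡j)
... | no i≢j  = inj₂ (punchOut i≢j , sym (punchIn-punchOut i≢j))

module _ {m} (A : Subset m) (i : Fin (suc m)) (b : Bool) where

  punchIn∈insertAt⁻ : ∀ k → punchIn i k ∈ insertAt A i b → k ∈ A
  punchIn∈insertAt⁻ k p = lookup⇒[]= k A (trans (sym (insertAt-punchIn A i b k)) ([]=⇒lookup p))

  punchIn∈insertAt⁺ : ∀ k → k ∈ A → punchIn i k ∈ insertAt A i b
  punchIn∈insertAt⁺ k p = lookup⇒[]= (punchIn i k) _ (trans (insertAt-punchIn A i b k) ([]=⇒lookup p))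

  ∈insertAt⁻ : i ∈ insertAt A i b → b ≡ inside
  ∈insertAt⁻ p = trans (sym (insertAt-lookup A i b)) ([]=⇒lookup p)

∣insertAt∣ : ∀ {m} (A : Subset m) i b → ∣ insertAt A i b ∣ ≡ (if b then suc ∣ A ∣ else ∣ A ∣)
∣insertAt∣ A           zero    true  = refl
∣insertAt∣ A           zero    false = refl
∣insertAt∣ (true  ∷ A) (suc i) true  = cong suc (∣insertAt∣ A i true)
∣insertAt∣ (true  ∷ A) (suc i) false = cong suc (∣insertAt∣ A i false)
∣insertAt∣ (false ∷ A) (suc i) b     = ∣insertAt∣ A i b

∈insertAt : ∀ {m} (A : Subset m) i → i ∈ insertAt A i inside
∈insertAt A i = lookup⇒[]= i _ (insertAt-lookup A i inside)

module _ {n m} (E : Edges n (suc m)) (A : Subset m) (i : Fin (suc m)) where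

  Reachable-insertAt : ∀ b {s t} → Reachable (removeAt E i) A s t → Reachable E (insertAt A i b) s t
  Reachable-insertAt b = Reachable-map id λ k k∈A o →
    inj₂ (punchIn i k , punchIn∈insertAt⁺ A i b k k∈A , subst (λ e → Orient e _ _) (lookup-removeAt E i k) o)

  module _ (b : Bool) (inert : b ≡ outside ⊎ proj₁ (lookup E i) ≡ proj₂ (lookup E i)) where

    Reachable-removeAt : ∀ {s t} → Reachable E (insertAt A i b) s t → Reachable (removeAt E i) A s t
    Reachable-removeAt = Reachable-map id edge
      where
      joins-nothing : ∀ {a a′} → b ≡ outside ⊎ proj₁ (lookup E i) ≡ proj₂ (lookup E i) →
                      i ∈ insertAt A i b → Orient (lookup E i) a a′ → a ≡ a′
      joins-nothing (inj₁ b≡outside) i∈A _ with () ← trans (sym b≡outside) (∈insertAt⁻ A i b i∈A)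
      joins-nothing (inj₂ loop) _ (inj₁ refl) = loop
      joins-nothing (inj₂ loop) _ (inj₂ refl) = sym loop
      edge : ∀ {a a′} j → j ∈ insertAt A i b → Orient (lookup E j) a a′ →
             a ≡ a′ ⊎ Adjacent (removeAt E i) A a a′
      edge j j∈A o with ≡⊎punchIn i j
      ... | inj₁ refl       = inj₁ (joins-nothing inert j∈A o)
      ... | inj₂ (k , refl) =
        inj₂ (k , punchIn∈insertAt⁻ A i b k j∈A , subst (λ e → Orient e _ _) (sym (lookup-removeAt E i k)) o)

    labelling-removeAt : ∀ {c} → IsComponentLabelling E (insertAt A i b) c → IsComponentLabelling (removeAt E i) A c
    labelling-removeAt L = record
      { inComponent = λ x → Reachable-removeAt (inComponent x)
      ; constant    = λ x x′ p → constant x x′ (Reachable-insertAt b p) }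
      where open IsComponentLabelling L

    labelling-insertAt : ∀ {c} → IsComponentLabelling (removeAt E i) A c → IsComponentLabelling E (insertAt A i b) c
    labelling-insertAt L = record
      { inComponent = λ x → Reachable-insertAt b (inComponent x)
      ; constant    = λ x x′ p → constant x x′ (Reachable-removeAt p) }
      where open IsComponentLabelling L

labelling-removeAt-outside : ∀ {n m} (E : Edges n (suc m)) (i : Fin (suc m)) {C : Subset (suc m) → Fin n → Fin n} →
  (∀ A → IsComponentLabelling E A (C A)) →
  ∀ A → IsComponentLabelling (removeAt E i) A (C (insertAt A i outside))
labelling-removeAt-outside E i L A = labelling-removeAt E A i outside (inj₁ refl) (L _)

redirect : ∀ {n} → Fin n → Fin n → Fin n → Fin n
redirect p q t = if does (t ≟ p) then q else t

labelling-∷-inside : ∀ {n m} {E : Edges n m} {A : Subset m} {c : Fin n → Fin n} (a a′ : Fin n) →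
  IsComponentLabelling E A c → IsComponentLabelling ((a , a′) ∷ E) (inside ∷ A) (redirect (c a) (c a′) ∘ c)
labelling-∷-inside {n} {E = E} {A} {c} a a′ L = record { inComponent = inComponent′ ; constant = constant′ }
  where
  open IsComponentLabelling L
  E′ = (a , a′) ∷ E
  lift : ∀ {s t} → Reachable E A s t → Reachable E′ (inside ∷ A) s t
  lift = Reachable-insertAt E′ A zero inside
  inComponent′ : ∀ x → Reachable E′ (inside ∷ A) x (redirect (c a) (c a′) (c x))
  inComponent′ x with c x ≟ c a
  ... | no _     = lift (inComponent x)
  ... | yes cx≡ca = Reachable-trans (Reachable-trans x⇝a (step zero here (inj₁ refl) here)) (lift (inComponent a′))
    where
    x⇝a : Reachable E′ (inside ∷ A) x a
    x⇝a = Reachable-trans (lift (inComponent x))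
            (subst (λ t → Reachable E′ _ t a) (sym cx≡ca) (lift (Reachable-sym (inComponent a))))
  redirect-a : redirect (c a) (c a′) (c a) ≡ c a′
  redirect-a with c a ≟ c a
  ... | yes _ = refl
  ... | no ca≢ca = ⊥-elim (ca≢ca refl)
  redirect-a′ : redirect (c a) (c a′) (c a′) ≡ c a′
  redirect-a′ with c a′ ≟ c a
  ... | yes _ = refl
  ... | no _  = refl
  constant′ : ∀ x x′ → Reachable E′ (inside ∷ A) x x′ →
              redirect (c a) (c a′) (c x) ≡ redirect (c a) (c a′) (c x′)
  constant′ x .x here = refl
  constant′ x x′ (step zero _ (inj₁ refl) p) = trans (constant′ x a p) (trans redirect-a (sym redirect-a′))
  constant′ x x′ (step zero _ (inj₂ refl) p) = trans (constant′ x a′ p) (trans redirect-a′ (sym redirect-a))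
  constant′ x x′ (step {t} (suc k) (there k∈A) o p) =
    trans (constant′ x t p) (cong (redirect (c a) (c a′)) (constant t x′ (step k k∈A o here)))

componentLabelling : ∀ {n m} (E : Edges n m) (A : Subset m) → Σ (Fin n → Fin n) (IsComponentLabelling E A)
componentLabelling []      [] = id , record { inComponent = λ _ → here ; constant = λ _ _ → Reachable-[] }
componentLabelling (e ∷ E) (outside ∷ A) =
  let c , L = componentLabelling E A in c , labelling-insertAt (e ∷ E) A zero outside (inj₁ refl) L
componentLabelling ((a , a′) ∷ E) (inside ∷ A) =
  let c , L = componentLabelling E A in redirect (c a) (c a′) ∘ c , labelling-∷-inside a a′ L

Additive : (Mark → ℕ) → Set
Additive h = ∀ m m′ → h (m ∔ m′) ≡ h m ℕ.+ h m′

w-additive : Additive w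
w-additive (mark _ _ _) (mark _ _ _) = refl

suc-d-additive : Additive (λ m → suc (d m))
suc-d-additive (mark _ d _) (mark _ d′ _) = cong suc (trans (ℕₚ.+-comm (d ℕ.+ d′) 1) (sym (ℕₚ.+-suc d d′)))

-- The dot-sum adds both w and d + 1, so total marks can be compared through sums of these.
Additive-injective : ∀ {m m′ : Mark} → (∀ h → Additive h → h m ≡ h m′) → m ≡ m′
Additive-injective {mark _ _ _} {mark _ _ _} same
  with refl ← same w w-additive | refl ← same (λ m → suc (d m)) suc-d-additive = refl

additive-foldl : ∀ h → Additive h → ∀ {b q} {B : Set b} {Q : B → Set q} (Q? : ∀ x → Dec (Q x))
  (g : B → Mark) {k} (f : Fin k → B) m₀ →
  h (foldl _∔_ m₀ (lmap g (filter Q? (tabulate f)))) ≡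
  h m₀ ℕ.+ sumℕ (λ x → if does (Q? (f x)) then h (g (f x)) else 0)
additive-foldl h add Q? g {zero}  f m₀ = sym (ℕₚ.+-identityʳ _)
additive-foldl h add Q? g {suc k} f m₀ with does (Q? (f zero))
... | true  = begin
  h (foldl _∔_ (m₀ ∔ g (f zero)) rest)    ≡⟨ additive-foldl h add Q? g (f ∘ suc) (m₀ ∔ g (f zero)) ⟩
  h (m₀ ∔ g (f zero)) ℕ.+ sumℕ tail         ≡⟨ cong (ℕ._+ sumℕ tail) (add m₀ (g (f zero))) ⟩
  h m₀ ℕ.+ h (g (f zero)) ℕ.+ sumℕ tail       ≡⟨ ℕₚ.+-assoc (h m₀) (h (g (f zero))) (sumℕ tail) ⟩
  h m₀ ℕ.+ (h (g (f zero)) ℕ.+ sumℕ tail)     ∎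
  where
  open ≡-Reasoning
  rest = lmap g (filter Q? (tabulate (f ∘ suc)))
  tail = λ x → if does (Q? (f (suc x))) then h (g (f (suc x))) else 0
... | false = additive-foldl h add Q? g (f ∘ suc) m₀

componentSum : ∀ {n} → (Mark → ℕ) → (Fin n → Mark) → (Fin n → Fin n) → Fin n → ℕ
componentSum h mk c r = sumℕ (λ x → if does (c x ≟ r) then h (mk x) else 0)

totalMark-additive : ∀ h → Additive h → ∀ {n} (mk : Fin n → Mark) (c : Fin n → Fin n) r →
  c r ≡ r → h (totalMark mk c r) ≡ componentSum h mk c r
totalMark-additive h add {zero}  mk c ()
totalMark-additive h add {suc n} mk c r cr≡r = begin
  h (totalMark mk c r)                    ≡⟨ additive-foldl h add Q? mk id (mk r) ⟩
  h (mk r) ℕ.+ sumℕ others                ≡⟨ cong (h (mk r) ℕ.+_) (sum-remove {i = r} others) ⟩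
  h (mk r) ℕ.+ (others r ℕ.+ rest others) ≡⟨ cong (λ t → h (mk r) ℕ.+ (t ℕ.+ rest others)) others-r ⟩
  h (mk r) ℕ.+ rest others                ≡⟨ cong (h (mk r) ℕ.+_) (sum-cong-≗ others≗class) ⟩
  h (mk r) ℕ.+ rest class                 ≡⟨ cong (ℕ._+ rest class) (sym class-r) ⟩
  class r ℕ.+ rest class                  ≡⟨ sym (sum-remove {i = r} class) ⟩
  sumℕ class                              ∎
  where
  open ≡-Reasoning
  open CommutativeMonoidSum ℕₚ.+-0-commutativeMonoid using (sum-remove; sum-cong-≗)
  Q? = λ x → ¬? (x ≟ r) ×-dec (c x ≟ r)
  others class : Fin (suc n) → ℕ
  others x = if does (Q? x) then h (mk x) else 0
  class  x = if does (c x ≟ r) then h (mk x) else 0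
  rest : (Fin (suc n) → ℕ) → ℕ
  rest f = sumℕ (f ∘ punchIn r)
  others-r : others r ≡ 0
  others-r rewrite dec-true (r ≟ r) refl = refl
  class-r : class r ≡ h (mk r)
  class-r rewrite dec-true (c r ≟ r) cr≡r = refl
  others≗class : ∀ k → others (punchIn r k) ≡ class (punchIn r k)
  others≗class k = cong (λ b → if b then h (mk (punchIn r k)) else 0)
    (does-⇔ (mk⇔ proj₂ (λ e → punchInᵢ≢i r k , e)) (Q? (punchIn r k)) (c (punchIn r k) ≟ r))

totalMark-discrete : ∀ {n} (mk : Fin n → Mark) (c : Fin n → Fin n) → (∀ x → c x ≡ x) →
                     ∀ r → totalMark mk c r ≡ mk r
totalMark-discrete mk c c-id r =
  cong (foldl _∔_ (mk r) ∘ lmap mk)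
       (filter-none (λ v → ¬? (v ≟ r) ×-dec (c v ≟ r))
                    (tabulate⁺ λ x (x≢r , cx≡r) → x≢r (trans (sym (c-id x)) cx≡r)))

module Merge {n} (u v : Fin (suc n)) (u≢v : u ≢ v) where

  merge : Fin (suc n) → Fin n
  merge = mergeV u v u≢v

  vₑ : Fin n
  vₑ = punchOut u≢v

  merge-u : merge u ≡ vₑ
  merge-u with u ≟ u
  ... | yes _   = refl
  ... | no u≢u′ = ⊥-elim (u≢u′ refl)

  merge-v : merge v ≡ vₑ
  merge-v with v ≟ u
  ... | yes v≡u = ⊥-elim (u≢v (sym v≡u))
  ... | no _    = punchOut-cong u refl

  merge-punchIn : ∀ j → merge (punchIn u j) ≡ j
  merge-punchIn j with punchIn u j ≟ u
  ... | yes p≡u = ⊥-elim (punchInᵢ≢i u j p≡u)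
  ... | no _    = trans (punchOut-cong u refl) (punchOut-punchIn u)

  punchIn-merge : ∀ x → x ≢ u → punchIn u (merge x) ≡ x
  punchIn-merge x x≢u with x ≟ u
  ... | yes x≡u = ⊥-elim (x≢u x≡u)
  ... | no _    = punchIn-punchOut _

  IsEnd : Fin (suc n) → Set
  IsEnd a = a ≡ u ⊎ a ≡ v

  merge-identifies : ∀ a b → merge a ≡ merge b → a ≡ b ⊎ IsEnd a × IsEnd b
  merge-identifies a b eq with a ≟ u | b ≟ u
  ... | yes a≡u | yes b≡u = inj₁ (trans a≡u (sym b≡u))
  ... | yes a≡u | no b≢u  = inj₂ (inj₁ a≡u , inj₂ (sym (punchOut-injective u≢v (b≢u ∘ sym) eq)))
  ... | no a≢u  | yes b≡u = inj₂ (inj₂ (punchOut-injective (a≢u ∘ sym) u≢v eq) , inj₁ b≡u)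
  ... | no a≢u  | no b≢u  = inj₁ (punchOut-injective (a≢u ∘ sym) (b≢u ∘ sym) eq)

  punchIn≢v : ∀ j → j ≢ vₑ → punchIn u j ≢ v
  punchIn≢v j j≢vₑ p≡v = j≢vₑ (trans (sym (merge-punchIn j)) (trans (cong merge p≡v) merge-v))

  module _ (mk : Fin (suc n) → Mark) where

    contractMarks-vₑ : contractMarks u v u≢v mk vₑ ≡ mk u ∔ mk v
    contractMarks-vₑ with vₑ ≟ vₑ
    ... | yes _ = refl
    ... | no vₑ≢vₑ = ⊥-elim (vₑ≢vₑ refl)

    contractMarks-punchIn : ∀ j → j ≢ vₑ → contractMarks u v u≢v mk j ≡ mk (punchIn u j)
    contractMarks-punchIn j j≢vₑ with j ≟ vₑ
    ... | yes j≡vₑ = ⊥-elim (j≢vₑ j≡vₑ)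
    ... | no _     = refl

  module _ (c : Fin (suc n) → Fin (suc n)) (cu≡cv : c u ≡ c v) (c-idem : ∀ x → c (c x) ≡ c x) where

    contractLabel : Fin n → Fin n
    contractLabel j = merge (c (punchIn u j))

    contractLabel-merge : ∀ x → contractLabel (merge x) ≡ merge (c x)
    contractLabel-merge x = by-cases (x ≟ u)
      where
      by-cases : Dec (x ≡ u) → contractLabel (merge x) ≡ merge (c x)
      by-cases (no x≢u)  = cong (merge ∘ c) (punchIn-merge x x≢u)
      by-cases (yes refl) = trans (cong contractLabel merge-u)
                                  (trans (cong (merge ∘ c) (punchIn-punchOut u≢v)) (cong merge (sym cu≡cv)))

    merge-injective-on-reps : ∀ a b → c a ≡ a → c b ≡ b → merge a ≡ merge b → a ≡ b
    merge-injective-on-reps a b ca≡a cb≡b eq with merge-identifies a b eq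
    ... | inj₁ a≡b                  = a≡b
    ... | inj₂ (inj₁ refl , inj₁ refl) = refl
    ... | inj₂ (inj₂ refl , inj₂ refl) = refl
    ... | inj₂ (inj₁ refl , inj₂ refl) = ⊥-elim (u≢v (trans (sym ca≡a) (trans cu≡cv cb≡b)))
    ... | inj₂ (inj₂ refl , inj₁ refl) = ⊥-elim (u≢v (trans (sym cb≡b) (trans cu≡cv ca≡a)))

    contractLabel-class : ∀ r x → c r ≡ r → contractLabel (merge x) ≡ merge r ⇔ c x ≡ r
    contractLabel-class r x cr≡r = mk⇔
      (λ e → merge-injective-on-reps (c x) r (c-idem x) cr≡r (trans (sym (contractLabel-merge x)) e))
      (λ e → trans (contractLabel-merge x) (cong merge e))

    contractLabel-rep : ∀ r → c r ≡ r → contractLabel (merge r) ≡ merge r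
    contractLabel-rep r cr≡r = Equivalence.from (contractLabel-class r r cr≡r) cr≡r

    rep-contractLabel : ∀ x → x ≢ u → x ≢ v → contractLabel (merge x) ≡ merge x → c x ≡ x
    rep-contractLabel x x≢u x≢v e with merge-identifies (c x) x (trans (sym (contractLabel-merge x)) e)
    ... | inj₁ cx≡x          = cx≡x
    ... | inj₂ (_ , inj₁ x≡u) = ⊥-elim (x≢u x≡u)
    ... | inj₂ (_ , inj₂ x≡v) = ⊥-elim (x≢v x≡v)

    rep-punchIn : ∀ j → j ≢ vₑ → contractLabel j ≡ j ⇔ c (punchIn u j) ≡ punchIn u j
    rep-punchIn j j≢vₑ = mk⇔
      (λ e → rep-contractLabel _ (punchInᵢ≢i u j) (punchIn≢v j j≢vₑ)
               (trans (cong contractLabel (merge-punchIn j)) (trans e (sym (merge-punchIn j)))))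
      (λ e → subst (λ t → contractLabel t ≡ t) (merge-punchIn j) (contractLabel-rep _ e))

    rep-vₑ : contractLabel vₑ ≡ vₑ ⇔ (c u ≡ u ⊎ c v ≡ v)
    rep-vₑ = mk⇔ to from
      where
      to : contractLabel vₑ ≡ vₑ → c u ≡ u ⊎ c v ≡ v
      to e with merge-identifies (c u) u (trans (sym (contractLabel-merge u))
                                           (subst (λ t → contractLabel t ≡ t) (sym merge-u) e))
      ... | inj₁ cu≡u            = inj₁ cu≡u
      ... | inj₂ (inj₁ cu≡u , _) = inj₁ cu≡u
      ... | inj₂ (inj₂ cu≡v , _) = inj₂ (trans (sym cu≡cv) cu≡v)
      from : c u ≡ u ⊎ c v ≡ v → contractLabel vₑ ≡ vₑ
      from (inj₁ cu≡u) = subst (λ t → contractLabel t ≡ t) merge-u (contractLabel-rep u cu≡u)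
      from (inj₂ cv≡v) = subst (λ t → contractLabel t ≡ t) merge-v (contractLabel-rep v cv≡v)

    sumRepresentatives-contract : ∀ {a ℓ} (M : CommutativeMonoid a ℓ) →
      let open CommutativeMonoid M in
      (g : Fin (suc n) → Carrier) (g′ : Fin n → Carrier) → (∀ r → c r ≡ r → g′ (merge r) ≈ g r) →
      sumRepresentatives M c g ≈ sumRepresentatives M contractLabel g′
    sumRepresentatives-contract M g g′ g′≈g = sum-merge M u v u≢v f f′ f′-vₑ f′-other
      where
      open CommutativeMonoid M hiding (refl; sym; trans)
      open CommutativeMonoid M using () renaming (refl to ≈-refl; sym to ≈-sym; trans to ≈-trans)
      f  = λ x → if does (c x ≟ x) then g x else ε
      f′ = λ j → if does (contractLabel j ≟ j) then g′ j else ε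
      f′-other : ∀ j → j ≢ vₑ → f′ j ≈ f (punchIn u j)
      f′-other j j≢vₑ rewrite does-⇔ (rep-punchIn j j≢vₑ) (contractLabel j ≟ j) (c (punchIn u j) ≟ punchIn u j)
        with c (punchIn u j) ≟ punchIn u j
      ... | yes e = ≈-trans (reflexive (cong g′ (sym (merge-punchIn j)))) (g′≈g _ e)
      ... | no _  = ≈-refl
      -- u and v share a class, so at most one of them represents it.
      f′-vₑ : f′ vₑ ≈ f u ∙ f v
      f′-vₑ with c u ≟ u | c v ≟ v
      ... | yes cu | yes cv = ⊥-elim (u≢v (trans (sym cu) (trans cu≡cv cv)))
      ... | yes cu | no _ rewrite dec-true (contractLabel vₑ ≟ vₑ) (Equivalence.from rep-vₑ (inj₁ cu)) =
        ≈-trans (≈-trans (reflexive (cong g′ (sym merge-u))) (g′≈g u cu)) (≈-sym (identityʳ _))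
      ... | no _ | yes cv rewrite dec-true (contractLabel vₑ ≟ vₑ) (Equivalence.from rep-vₑ (inj₂ cv)) =
        ≈-trans (≈-trans (reflexive (cong g′ (sym merge-v))) (g′≈g v cv)) (≈-sym (identityˡ _))
      ... | no cu | no cv rewrite dec-false (contractLabel vₑ ≟ vₑ) (λ e → [ cu , cv ] (Equivalence.to rep-vₑ e)) =
        ≈-sym (identityˡ _)

    componentSum-contract : ∀ h → Additive h → (mk : Fin (suc n) → Mark) → ∀ r → c r ≡ r →
      componentSum h mk c r ≡ componentSum h (contractMarks u v u≢v mk) contractLabel (merge r)
    componentSum-contract h add mk r cr≡r = sum-merge ℕₚ.+-0-commutativeMonoid u v u≢v f f′ f′-vₑ f′-other
      where
      open ≡-Reasoning
      mk′ = contractMarks u v u≢v mk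
      f  = λ x → if does (c x ≟ r) then h (mk x) else 0
      f′ = λ j → if does (contractLabel j ≟ merge r) then h (mk′ j) else 0
      in-class : ∀ x {j} → merge x ≡ j → does (contractLabel j ≟ merge r) ≡ does (c x ≟ r)
      in-class x refl = does-⇔ (contractLabel-class r x cr≡r) (contractLabel (merge x) ≟ merge r) (c x ≟ r)
      f′-other : ∀ j → j ≢ vₑ → f′ j ≡ f (punchIn u j)
      f′-other j j≢vₑ rewrite contractMarks-punchIn mk j j≢vₑ | in-class (punchIn u j) (merge-punchIn j) = refl
      f′-vₑ : f′ vₑ ≡ f u ℕ.+ f v
      f′-vₑ rewrite contractMarks-vₑ mk | add (mk u) (mk v) | in-class u merge-u | cu≡cv with does (c v ≟ r)
      ... | true  = refl
      ... | false = refl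

    totalMark-contract : (mk : Fin (suc n) → Mark) → ∀ r → c r ≡ r →
      totalMark (contractMarks u v u≢v mk) contractLabel (merge r) ≡ totalMark mk c r
    totalMark-contract mk r cr≡r = Additive-injective λ h add →
      trans (totalMark-additive h add _ contractLabel (merge r) (contractLabel-rep r cr≡r))
            (trans (sym (componentSum-contract h add mk r cr≡r)) (sym (totalMark-additive h add mk c r cr≡r)))

module Contraction {n m} (E : Edges (suc n) (suc m)) (A : Subset m) (i : Fin (suc m))
                   {u v : Fin (suc n)} (eᵢ : lookup E i ≡ (u , v)) (u≢v : u ≢ v) where
  open Merge u v u≢v public

  A⁺ : Subset (suc m)
  A⁺ = insertAt A i inside

  E′ : Edges n m
  E′ = contractEdges u v u≢v (removeAt E i)

  lookup-E′ : ∀ k → lookup E′ k ≡ (merge (proj₁ (lookup E (punchIn i k))) ,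
                                   merge (proj₂ (lookup E (punchIn i k))))
  lookup-E′ k = trans (lookup-map k _ (removeAt E i))
    (cong (λ e → merge (proj₁ e) , merge (proj₂ e)) (lookup-removeAt E i k))

  Reachable-merged : ∀ a b → merge a ≡ merge b → Reachable E A⁺ a b
  Reachable-merged a b eq with merge-identifies a b eq
  ... | inj₁ refl                    = here
  ... | inj₂ (inj₁ refl , inj₁ refl) = here
  ... | inj₂ (inj₂ refl , inj₂ refl) = here
  ... | inj₂ (inj₁ refl , inj₂ refl) = step i (∈insertAt A i) (inj₁ eᵢ) here
  ... | inj₂ (inj₂ refl , inj₁ refl) = step i (∈insertAt A i) (inj₂ eᵢ) here

  Reachable-contract : ∀ {s t} → Reachable E A⁺ s t → Reachable E′ A (merge s) (merge t)
  Reachable-contract = Reachable-map merge edge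
    where
    ends-merge : ∀ {a b} → Orient (u , v) a b → merge a ≡ merge b
    ends-merge (inj₁ refl) = trans merge-u (sym merge-v)
    ends-merge (inj₂ refl) = trans merge-v (sym merge-u)
    merge-orient : ∀ {e : Fin (suc n) × Fin (suc n)} {a b} → Orient e a b →
                   Orient (merge (proj₁ e) , merge (proj₂ e)) (merge a) (merge b)
    merge-orient (inj₁ refl) = inj₁ refl
    merge-orient (inj₂ refl) = inj₂ refl
    edge : ∀ {a b} j → j ∈ A⁺ → Orient (lookup E j) a b →
           merge a ≡ merge b ⊎ Adjacent E′ A (merge a) (merge b)
    edge j j∈A⁺ o with ≡⊎punchIn i j
    ... | inj₁ refl       = inj₁ (ends-merge (subst (λ e → Orient e _ _) eᵢ o))
    ... | inj₂ (k , refl) = inj₂ (k , punchIn∈insertAt⁻ A i inside k j∈A⁺ ,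
                                  subst (λ e → Orient e _ _) (sym (lookup-E′ k)) (merge-orient o))

  Reachable-lift : ∀ {j j′} → Reachable E′ A j j′ → ∀ x → merge x ≡ j →
                   Σ (Fin (suc n)) λ x′ → merge x′ ≡ j′ × Reachable E A⁺ x x′
  Reachable-lift here x mx≡j = x , mx≡j , here
  Reachable-lift (step {a} {b} k k∈A o p) x mx≡j with Reachable-lift p x mx≡j
  ... | x′ , mx′≡a , x⇝x′ = extend (subst (λ e → Orient e a b) (lookup-E′ k) o)
    where
    p₀ = proj₁ (lookup E (punchIn i k))
    q₀ = proj₂ (lookup E (punchIn i k))
    k∈A⁺ = punchIn∈insertAt⁺ A i inside k k∈A
    extend : Orient (merge p₀ , merge q₀) a b → Σ (Fin (suc n)) λ x″ → merge x″ ≡ b × Reachable E A⁺ x x″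
    extend (inj₁ eq) = q₀ , cong proj₂ eq , step (punchIn i k) k∈A⁺ (inj₁ refl)
      (Reachable-trans x⇝x′ (Reachable-merged x′ p₀ (trans mx′≡a (sym (cong proj₁ eq)))))
    extend (inj₂ eq) = p₀ , cong proj₁ eq , step (punchIn i k) k∈A⁺ (inj₂ refl)
      (Reachable-trans x⇝x′ (Reachable-merged x′ q₀ (trans mx′≡a (sym (cong proj₂ eq)))))

  module _ {c : Fin (suc n) → Fin (suc n)} (L : IsComponentLabelling E A⁺ c) where
    open IsComponentLabelling L

    cu≡cv : c u ≡ c v
    cu≡cv = constant u v (step i (∈insertAt A i) (inj₁ eᵢ) here)

    c′ : Fin n → Fin n
    c′ = contractLabel c cu≡cv (labelling-idem L)

    labelling-contract : IsComponentLabelling E′ A c′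
    labelling-contract = record { inComponent = inComponent′ ; constant = constant′ }
      where
      inComponent′ : ∀ j → Reachable E′ A j (c′ j)
      inComponent′ j = subst (λ t → Reachable E′ A t (c′ j)) (merge-punchIn j)
                             (Reachable-contract (inComponent (punchIn u j)))
      constant′ : ∀ j j′ → Reachable E′ A j j′ → c′ j ≡ c′ j′
      constant′ j j′ p with Reachable-lift p (punchIn u j) (merge-punchIn j)
      ... | x′ , mx′≡j′ , q = cong merge (trans (constant _ _ q) (constant _ _
              (Reachable-merged x′ (punchIn u j′) (trans mx′≡j′ (sym (merge-punchIn j′))))))

    componentCount-contract : componentCount c ≡ componentCount c′
    componentCount-contract =
      sumRepresentatives-contract c cu≡cv (labelling-idem L) ℕₚ.+-0-commutativeMonoid
                                  (λ _ → 1) (λ _ → 1) (λ _ _ → refl)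

    nullity-contract : nullity A⁺ c ≡ nullity A c′
    nullity-contract = cong₂ _∸_ (∣insertAt∣ A i inside)
      (trans (cong (suc n ∸_) componentCount-contract) (ℕₚ.+-∸-assoc 1 (count≤ (λ x → does (c′ x ≟ x)))))

-- r(A) ≤ |A|, so the exponent |A| ∸ r(A) of term never truncates.
vertices≤components+edges : ∀ {n m} (E : Edges n m) (A : Subset m) {c : Fin n → Fin n} →
  IsComponentLabelling E A c → n ≤ componentCount c ℕ.+ ∣ A ∣
vertices≤components+edges [] [] {c} L =
  ℕₚ.≤-reflexive (trans (sym (componentCount-discrete c (labelling-[] L))) (sym (ℕₚ.+-identityʳ _)))
vertices≤components+edges (e ∷ E) (outside ∷ A) L =
  vertices≤components+edges E A (labelling-removeAt (e ∷ E) A zero outside (inj₁ refl) L)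
vertices≤components+edges (e ∷ E) (inside ∷ A) {c} L with proj₁ e ≟ proj₂ e
... | yes loop = ℕₚ.≤-trans (vertices≤components+edges E A (labelling-removeAt (e ∷ E) A zero inside (inj₂ loop) L))
                         (ℕₚ.+-monoʳ-≤ (componentCount c) (ℕₚ.n≤1+n _))
vertices≤components+edges {zero}  ((() , _) ∷ E) (inside ∷ A) L | no _
vertices≤components+edges {suc n} (e ∷ E) (inside ∷ A) {c} L | no u≢v =
  subst (suc n ≤_) (trans (cong (λ k → suc (k ℕ.+ ∣ A ∣)) (sym (componentCount-contract L)))
                          (sym (ℕₚ.+-suc _ _)))
        (s≤s (vertices≤components+edges E′ A (labelling-contract L)))
  where open Contraction (e ∷ E) A zero refl u≢v

module _ {a ℓ} (R : CommutativeRing a ℓ) (z : Mark → CommutativeRing.Carrier R) (y : CommutativeRing.Carrier R) where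
  open CommutativeRing R hiding (refl; sym; trans; zero)
  open CommutativeRing R using () renaming (refl to ≈-refl; sym to ≈-sym; trans to ≈-trans)
  open WithRing R
  open CommutativeMonoidSum *-commutativeMonoid using () renaming (sum to product)
  open RingProperties ring using (-1*x≈-x)
  open CommutativeSemigroupProperties +-commutativeSemigroup using () renaming (interchange to +-interchange)
  open CommutativeSemigroupProperties *-commutativeSemigroup using (x∙yz≈y∙xz)
  open import Relation.Binary.Reasoning.Setoid setoid

  sumSubsets-cong : ∀ m {f g : Subset m → Carrier} → (∀ A → f A ≈ g A) → sumSubsets m f ≈ sumSubsets m g
  sumSubsets-cong zero    f≈g = f≈g []
  sumSubsets-cong (suc m) f≈g =
    +-cong (sumSubsets-cong m (f≈g ∘ (outside ∷_))) (sumSubsets-cong m (f≈g ∘ (inside ∷_)))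

  sumSubsets-*ˡ : ∀ m k (f : Subset m → Carrier) → sumSubsets m (λ A → k * f A) ≈ k * sumSubsets m f
  sumSubsets-*ˡ zero    k f = ≈-refl
  sumSubsets-*ˡ (suc m) k f = ≈-trans (+-cong (sumSubsets-*ˡ m k _) (sumSubsets-*ˡ m k _)) (≈-sym (distribˡ k _ _))

  sumSubsets-insertAt : ∀ m (i : Fin (suc m)) (f : Subset (suc m) → Carrier) →
    sumSubsets (suc m) f ≈ sumSubsets m (λ A → f (insertAt A i outside)) + sumSubsets m (λ A → f (insertAt A i inside))
  sumSubsets-insertAt m       zero    f = ≈-refl
  sumSubsets-insertAt (suc m) (suc i) f =
    ≈-trans (+-cong (sumSubsets-insertAt m i (f ∘ (outside ∷_))) (sumSubsets-insertAt m i (f ∘ (inside ∷_))))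
            (+-interchange _ _ _ _)

  prodFin≈product : ∀ {n} (f : Fin n → Carrier) → prodFin f ≈ product f
  prodFin≈product {zero}  f = ≈-refl
  prodFin≈product {suc n} f = *-congˡ (prodFin≈product (f ∘ suc))

  y-1 : Carrier
  y-1 = y + - 1#

  x+[y-1]x≈yx : ∀ x → x + y-1 * x ≈ y * x
  x+[y-1]x≈yx x = begin
    x + y-1 * x            ≈⟨ +-congˡ (distribʳ x y (- 1#)) ⟩
    x + (y * x + - 1# * x) ≈⟨ +-congˡ (+-congˡ (-1*x≈-x x)) ⟩
    x + (y * x + - x)      ≈⟨ +-congˡ (+-comm _ _) ⟩
    x + (- x + y * x)      ≈⟨ ≈-sym (+-assoc _ _ _) ⟩
    (x + - x) + y * x      ≈⟨ +-congʳ (-‿inverseʳ x) ⟩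
    0# + y * x             ≈⟨ +-identityˡ _ ⟩
    y * x                  ∎

  componentProduct : ∀ {n} → (Fin n → Mark) → (Fin n → Fin n) → Carrier
  componentProduct mk c = sumRepresentatives *-commutativeMonoid c (z ∘ totalMark mk c)

  term≈ : ∀ {n m} (mk : Fin n → Mark) (A : Subset m) (c : Fin n → Fin n) →
          term z y mk A c ≈ componentProduct mk c * pow y-1 (nullity A c)
  term≈ {n} mk A c = *-cong (foldr-filter-tabulate *-commutativeMonoid (λ r → c r ≟ r) (z ∘ totalMark mk c) id)
                            (reflexive (cong (λ k → pow y-1 (∣ A ∣ ∸ (n ∸ k))) (numComponents≡componentCount c)))

  term-∣∣ : ∀ {n m m′} (mk : Fin n → Mark) (A : Subset m) (A′ : Subset m′) (c : Fin n → Fin n) →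
            ∣ A ∣ ≡ ∣ A′ ∣ → term z y mk A c ≡ term z y mk A′ c
  term-∣∣ {n} mk A A′ c eq =
    cong (λ k → prodList (lmap (z ∘ totalMark mk c) (representatives c)) * pow y-1 (k ∸ (n ∸ numComponents c))) eq

  term-suc : ∀ {n m m′} (mk : Fin n → Mark) (A : Subset m) (A′ : Subset m′) (c : Fin n → Fin n) →
             ∣ A ∣ ≡ suc ∣ A′ ∣ → n ≤ componentCount c ℕ.+ ∣ A′ ∣ →
             term z y mk A c ≈ y-1 * term z y mk A′ c
  term-suc {n} mk A A′ c eq rank≤ = begin
    term z y mk A c                          ≈⟨ term≈ mk A c ⟩
    P * pow y-1 (∣ A ∣ ∸ r)                  ≡⟨ cong (λ k → P * pow y-1 (k ∸ r)) eq ⟩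
    P * pow y-1 (suc ∣ A′ ∣ ∸ r)              ≡⟨ cong (λ k → P * pow y-1 k) (ℕₚ.+-∸-assoc 1 r≤∣A′∣) ⟩
    P * (y-1 * pow y-1 (nullity A′ c))       ≈⟨ x∙yz≈y∙xz P y-1 _ ⟩
    y-1 * (P * pow y-1 (nullity A′ c))       ≈⟨ *-congˡ (≈-sym (term≈ mk A′ c)) ⟩
    y-1 * term z y mk A′ c                   ∎
    where
    P = componentProduct mk c
    r = n ∸ componentCount c
    r≤∣A′∣ : r ≤ ∣ A′ ∣
    r≤∣A′∣ = ℕₚ.≤-trans (ℕₚ.∸-monoˡ-≤ (componentCount c) rank≤)
                       (ℕₚ.≤-reflexive (ℕₚ.m+n∸m≡n (componentCount c) ∣ A′ ∣))

  subsetSum-[] : ∀ {n} (mk : Fin n → Mark) (C : Subset 0 → Fin n → Fin n) → IsComponentLabelling [] [] (C []) →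
                 prodFin (z ∘ mk) ≈ subsetSum z y [] mk C
  subsetSum-[] {n} mk C L = begin
    prodFin (z ∘ mk)                          ≈⟨ prodFin≈product (z ∘ mk) ⟩
    product (z ∘ mk)                          ≈⟨ sum-cong-≋ factor ⟩
    componentProduct mk c                     ≈⟨ ≈-sym (*-identityʳ _) ⟩
    componentProduct mk c * 1#                ≡⟨ cong (λ k → componentProduct mk c * pow y-1 k)
                                                      (sym (ℕₚ.0∸n≡0 (n ∸ componentCount c))) ⟩
    componentProduct mk c * pow y-1 (nullity [] c) ≈⟨ ≈-sym (term≈ mk [] c) ⟩
    term z y mk [] c                          ∎
    where
    open CommutativeMonoidSum *-commutativeMonoid using (sum-cong-≋)
    c = C []
    factor : ∀ x → z (mk x) ≈ (if does (c x ≟ x) then z (totalMark mk c x) else 1#)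
    factor x rewrite dec-true (c x ≟ x) (labelling-[] L x) =
      reflexive (cong z (sym (totalMark-discrete mk c (labelling-[] L) x)))

  subsetSum-insertAt : ∀ {n m} (E : Edges n (suc m)) (mk : Fin n → Mark) (i : Fin (suc m))
    (C : Subset (suc m) → Fin n → Fin n) →
    subsetSum z y E mk C ≈ subsetSum z y (removeAt E i) mk (λ A → C (insertAt A i outside))
                           + sumSubsets m (λ A → term z y mk (insertAt A i inside) (C (insertAt A i inside)))
  subsetSum-insertAt {m = m} E mk i C = ≈-trans (sumSubsets-insertAt m i (λ A → term z y mk A (C A)))
    (+-congʳ (sumSubsets-cong m λ A →
      reflexive (term-∣∣ mk (insertAt A i outside) A (C (insertAt A i outside)) (∣insertAt∣ A i outside))))

  subsetSum-loop : ∀ {n m} (E : Edges n (suc m)) (mk : Fin n → Mark) (i : Fin (suc m)) →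
    proj₁ (lookup E i) ≡ proj₂ (lookup E i) →
    (C : Subset (suc m) → Fin n → Fin n) → (∀ A → IsComponentLabelling E A (C A)) →
    subsetSum z y E mk C ≈ subsetSum z y (removeAt E i) mk (λ A → C (insertAt A i outside))
                           + y-1 * subsetSum z y (removeAt E i) mk (λ A → C (insertAt A i inside))
  subsetSum-loop {m = m} E mk i loop C L = ≈-trans (subsetSum-insertAt E mk i C) (+-congˡ (≈-trans
    (sumSubsets-cong m λ A → term-suc mk (insertAt A i inside) A (C (insertAt A i inside)) (∣insertAt∣ A i inside)
      (vertices≤components+edges (removeAt E i) A (labelling-removeAt E A i inside (inj₂ loop) (L _))))
    (sumSubsets-*ˡ m y-1 _)))

  module _ {n m} (E : Edges (suc n) (suc m)) (mk : Fin (suc n) → Mark) (i : Fin (suc m))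
           (u≢v : proj₁ (lookup E i) ≢ proj₂ (lookup E i))
           (C : Subset (suc m) → Fin (suc n) → Fin (suc n)) (L : ∀ A → IsComponentLabelling E A (C A)) where

    contractLabelling : Subset m → Fin n → Fin n
    contractLabelling A = Contraction.c′ E A i refl u≢v (L (insertAt A i inside))

    contractLabelling-labels : ∀ A → IsComponentLabelling (contractEdges _ _ u≢v (removeAt E i)) A
                                                          (contractLabelling A)
    contractLabelling-labels A = Contraction.labelling-contract E A i refl u≢v (L (insertAt A i inside))

    term-contract : ∀ A → term z y mk (insertAt A i inside) (C (insertAt A i inside))
                          ≈ term z y (contractMarks _ _ u≢v mk) A (contractLabelling A)
    term-contract A = begin
      term z y mk A⁺ c                       ≈⟨ term≈ mk A⁺ c ⟩
      componentProduct mk c * pow y-1 (nullity A⁺ c)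
        ≈⟨ *-cong product≈ (reflexive (cong (pow y-1) (nullity-contract L′))) ⟩
      componentProduct mk′ cₑ * pow y-1 (nullity A cₑ) ≈⟨ ≈-sym (term≈ mk′ A cₑ) ⟩
      term z y mk′ A cₑ                      ∎
      where
      open Contraction E A i refl u≢v
      L′ = L A⁺
      c = C A⁺
      cₑ = c′ L′
      mk′ = contractMarks _ _ u≢v mk
      product≈ : componentProduct mk c ≈ componentProduct mk′ cₑ
      product≈ = sumRepresentatives-contract c (cu≡cv L′) (labelling-idem L′) *-commutativeMonoid _ _
        λ r cr≡r → reflexive (cong z (totalMark-contract c (cu≡cv L′) (labelling-idem L′) mk r cr≡r))

    subsetSum-deletion-contraction :
      subsetSum z y E mk C ≈ subsetSum z y (removeAt E i) mk (λ A → C (insertAt A i outside))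
                             + subsetSum z y (contractEdges _ _ u≢v (removeAt E i)) (contractMarks _ _ u≢v mk)
                                         contractLabelling
    subsetSum-deletion-contraction = ≈-trans (subsetSum-insertAt E mk i C) (+-congˡ (sumSubsets-cong m term-contract))

  Computes⇒≈subsetSum : ∀ {n m} {E : Edges n m} {mk : Fin n → Mark} {val} → Computes z y E mk val →
    ∀ C → (∀ A → IsComponentLabelling E A (C A)) → val ≈ subsetSum z y E mk C
  Computes⇒≈subsetSum (ruleA mk) C L = subsetSum-[] mk C (L [])
  Computes⇒≈subsetSum (ruleB E mk i {v} loop d) C L = begin
    y * v                   ≈⟨ ≈-sym (x+[y-1]x≈yx v) ⟩
    v + y-1 * v             ≈⟨ +-cong (Computes⇒≈subsetSum d _ (labelling-removeAt-outside E i L))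
                                      (*-congˡ (Computes⇒≈subsetSum d _ loop-deleted)) ⟩
    _ + y-1 * _             ≈⟨ ≈-sym (subsetSum-loop E mk i loop C L) ⟩
    subsetSum z y E mk C    ∎
    where
    loop-deleted : ∀ A → IsComponentLabelling (removeAt E i) A (C (insertAt A i inside))
    loop-deleted A = labelling-removeAt E A i inside (inj₂ loop) (L _)
  Computes⇒≈subsetSum (ruleC E mk i u≢v {v₁} {v₂} d₁ d₂) C L = begin
    v₁ + v₂                 ≈⟨ +-cong (Computes⇒≈subsetSum d₁ _ (labelling-removeAt-outside E i L))
                                      (Computes⇒≈subsetSum d₂ _ (contractLabelling-labels E mk i u≢v C L)) ⟩
    _ + _                   ≈⟨ ≈-sym (subsetSum-deletion-contraction E mk i u≢v C L) ⟩
    subsetSum z y E mk C    ∎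

  computes : ∀ {n m} (E : Edges n m) (mk : Fin n → Mark) → Σ Carrier (Computes z y E mk)
  computes [] mk = _ , ruleA mk
  computes {zero}  ((() , _) ∷ E) mk
  computes {suc n} E@(e ∷ _) mk with proj₁ e ≟ proj₂ e
  ... | yes loop = let v , d = computes (removeAt E zero) mk in y * v , ruleB E mk zero loop d
  ... | no u≢v   = let v₁ , d₁ = computes (removeAt E zero) mk
                       v₂ , d₂ = computes (contractEdges _ _ u≢v (removeAt E zero)) (contractMarks _ _ u≢v mk)
                   in v₁ + v₂ , ruleC E mk zero u≢v d₁ d₂

proposition4p3 : ∀ {c ℓ : Level} (R : CommutativeRing c ℓ)
    (z : Mark → CommutativeRing.Carrier R) (y : CommutativeRing.Carrier R)
    {n m : ℕ} (E : Edges n m) (mk : Fin n → Mark) →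
    Σ (CommutativeRing.Carrier R) (WithRing.Computes R z y E mk)
    × Σ (Subset m → Fin n → Fin n) (λ C → ∀ A → IsComponentLabelling E A (C A))
    × (∀ (C : Subset m → Fin n → Fin n) → (∀ A → IsComponentLabelling E A (C A)) →
       ∀ val → WithRing.Computes R z y E mk val →
       CommutativeRing._≈_ R val (WithRing.subsetSum R z y E mk C))
proposition4p3 R z y E mk =
  computes R z y E mk ,
  (proj₁ ∘ componentLabelling E , proj₂ ∘ componentLabelling E) ,
  λ C L _ d → Computes⇒≈subsetSum R z y d C L
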